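{- Let $(\mathcal{T}_r)_{r\in\mathbb{Z}}$ be any generalized Tribonacci sequence. Then for every nonnegative integer $k$ and every integer $r$, \[ \sum_{j=0}^{k}(-1)^{k-j}\binom kj103^{k-j}56^j\mathcal{T}_{r+16k+j}=\mathcal{T}_r, \] \[ \sum_{j=0}^{k}103^j\binom kj\mathcal{T}_{r-17k+16j}=56^k\mathcal{T}_r, \] and \[ \sum_{j=0}^{k}(-1)^j\binom kj56^j\mathcal{T}_{r-16k+17j}=(-103)^k\mathcal{T}_r. \]
   Context: A generalized Tribonacci sequence is any sequence $(\mathcal{T}_r)_{r\in\mathbb{Z}}$ of complex numbers with $\mathcal{T}_r=\mathcal{T}_{r-1}+\mathcal{T}_{r-2}+\mathcal{T}_{r-3}$ for all $r\in\mathbb{Z}$. -}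

module Defs where

open import Algebra.Bundles using (CommutativeRing)
open import Data.Nat using (ℕ; zero; suc)
open import Data.Integer using (ℤ; +_) renaming (_-_ to _-ℤ_)

module _ {c ℓ} (R : CommutativeRing c ℓ) where
  open CommutativeRing R

  fromℕ : ℕ → Carrier
  fromℕ zero = 0#
  fromℕ (suc n) = 1# + fromℕ n

  pow : Carrier → ℕ → Carrier
  pow x zero = 1#
  pow x (suc n) = x * pow x n

  sumTo : ℕ → (ℕ → Carrier) → Carrier
  sumTo zero f = f 0
  sumTo (suc k) f = sumTo k f + f (suc k)

  IsTribonacci : (ℤ → Carrier) → Set ℓ
  IsTribonacci T = ∀ (r : ℤ) → T r ≈ (T (r -ℤ + 1) + T (r -ℤ + 2)) + T (r -ℤ + 3)

{-# OPTIONS --safe #-}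
-- Writing T (s + n) in the basis T s, T (s + 1), T (s + 2) with Tribonacci numbers as
-- coefficients turns 56 T (r + 17) = 103 T (r + 16) + T r into three identities between
-- natural numbers, checked by computation (equivalently, x³ − x² − x − 1 divides
-- 56 x¹⁷ − 103 x¹⁶ − 1). By Pascal's rule, any relation α T (r + d) + β T (r + e) = γ T r
-- iterates to Σⱼ C(k, j) α^(k − j) β^j T (r + (k − j) d + j e) = γ^k T r, and the three
-- identities are this iteration applied to the key relation rearranged as
-- −103 T (r + 16) + 56 T (r + 17) = T r,  T (r − 17) + 103 T (r − 1) = 56 T r  and
-- T (r − 16) − 56 T (r + 1) = −103 T r.
module Submission where

open import Defs
open import Algebra.Bundles using (CommutativeRing)
open import Data.Nat using (ℕ; zero; suc; _∸_; _≤_; z≤n) renaming (_*_ to _*ℕ_; _+_ to _+ℕ_)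
open import Data.Nat.Combinatorics using (_C_; nCk+nC[k+1]≡[n+1]C[k+1]; k>n⇒nCk≡0)
open import Data.Nat.Properties using (m∸n+n≡m; +-∸-assoc; m≤n⇒m≤1+n; ≤-refl; n<1+n)
open import Data.Integer using (ℤ; +_)
  renaming (_+_ to _+ℤ_; _-_ to _-ℤ_; _*_ to _*ℤ_; -_ to -ℤ_)
import Data.Integer.Properties as ℤP
open import Data.Integer.Tactic.RingSolver using (solve-∀)
open import Data.Product using (_×_; _,_)
open import Relation.Binary.PropositionalEquality as ≡ using (_≡_)

pos-∸+ : ∀ {k j} → j ≤ k → + k ≡ + (k ∸ j) +ℤ + j
pos-∸+ {k} {j} j≤k = ≡.trans (≡.cong +_ (≡.sym (m∸n+n≡m j≤k))) (ℤP.pos-+ (k ∸ j) j)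

pos-*-∸+ : ∀ a {k j} → j ≤ k → + (a *ℕ k) ≡ + a *ℤ (+ (k ∸ j) +ℤ + j)
pos-*-∸+ a j≤k = ≡.trans (ℤP.pos-* a _) (≡.cong (+ a *ℤ_) (pos-∸+ j≤k))

index₁ : ∀ r {k j} → j ≤ k → r +ℤ + (16 *ℕ k +ℕ j) ≡ (r +ℤ + (k ∸ j) *ℤ + 16) +ℤ + j *ℤ + 17
index₁ r {k} {j} j≤k = ≡.trans
  (≡.cong (r +ℤ_) (≡.trans (ℤP.pos-+ (16 *ℕ k) j) (≡.cong (_+ℤ + j) (pos-*-∸+ 16 j≤k))))
  (linear r (+ (k ∸ j)) (+ j))
  where
  linear : ∀ r m j → r +ℤ (+ 16 *ℤ (m +ℤ j) +ℤ j) ≡ (r +ℤ m *ℤ + 16) +ℤ j *ℤ + 17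
  linear = solve-∀

index₂ : ∀ r {k j} → j ≤ k →
  (r -ℤ + (17 *ℕ k)) +ℤ + (16 *ℕ j) ≡ (r +ℤ + (k ∸ j) *ℤ (-ℤ + 17)) +ℤ + j *ℤ (+ 16 -ℤ + 17)
index₂ r {k} {j} j≤k = ≡.trans
  (≡.cong₂ (λ a b → (r -ℤ a) +ℤ b) (pos-*-∸+ 17 j≤k) (ℤP.pos-* 16 j))
  (linear r (+ (k ∸ j)) (+ j))
  where
  linear : ∀ r m j → (r -ℤ + 17 *ℤ (m +ℤ j)) +ℤ + 16 *ℤ j ≡ (r +ℤ m *ℤ (-ℤ + 17)) +ℤ j *ℤ (+ 16 -ℤ + 17)
  linear = solve-∀

index₃ : ∀ r {k j} → j ≤ k →
  (r -ℤ + (16 *ℕ k)) +ℤ + (17 *ℕ j) ≡ (r +ℤ + (k ∸ j) *ℤ (-ℤ + 16)) +ℤ + j *ℤ (+ 17 -ℤ + 16)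
index₃ r {k} {j} j≤k = ≡.trans
  (≡.cong₂ (λ a b → (r -ℤ a) +ℤ b) (pos-*-∸+ 16 j≤k) (ℤP.pos-* 17 j))
  (linear r (+ (k ∸ j)) (+ j))
  where
  linear : ∀ r m j → (r -ℤ + 16 *ℤ (m +ℤ j)) +ℤ + 17 *ℤ j ≡ (r +ℤ m *ℤ (-ℤ + 16)) +ℤ j *ℤ (+ 17 -ℤ + 16)
  linear = solve-∀

tribonacciℕ : ℕ → ℕ → ℕ → ℕ → ℕ
tribonacciℕ x y z zero    = x
tribonacciℕ x y z (suc n) = tribonacciℕ y z ((z +ℕ y) +ℕ x) n

tribonacciℕ-rec : ∀ x y z n → tribonacciℕ x y z (3 +ℕ n)
  ≡ (tribonacciℕ x y z (2 +ℕ n) +ℕ tribonacciℕ x y z (1 +ℕ n)) +ℕ tribonacciℕ x y z n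
tribonacciℕ-rec x y z zero    = ≡.refl
tribonacciℕ-rec x y z (suc n) = tribonacciℕ-rec y z ((z +ℕ y) +ℕ x) n

basis₀ basis₁ basis₂ : ℕ → ℕ
basis₀ = tribonacciℕ 1 0 0
basis₁ = tribonacciℕ 0 1 0
basis₂ = tribonacciℕ 0 0 1

56·basis₀17 : 56 *ℕ basis₀ 17 ≡ 103 *ℕ basis₀ 16 +ℕ 1
56·basis₀17 = ≡.refl

56·basis₁17 : 56 *ℕ basis₁ 17 ≡ 103 *ℕ basis₁ 16 +ℕ 0
56·basis₁17 = ≡.refl

56·basis₂17 : 56 *ℕ basis₂ 17 ≡ 103 *ℕ basis₂ 16 +ℕ 0
56·basis₂17 = ≡.refl

module _ {c ℓ} (R : CommutativeRing c ℓ) where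
  open CommutativeRing R
  open import Relation.Binary.Reasoning.Setoid setoid
  open import Algebra.Properties.Ring ring using (-‿distribˡ-*; -1*x≈-x)
  open import Algebra.Properties.Group +-group using (y≈x\\z; x≈z//y)
  open import Algebra.Properties.AbelianGroup +-abelianGroup using (⁻¹-anti-homo‿-)
  open import Algebra.Properties.Semiring.Mult semiring using (×-homo-+; ×1-homo-*) renaming (_×_ to _·_)
  open import Algebra.Solver.Ring.NaturalCoefficients.Default commutativeSemiring
    using (solve; _:+_; _:*_; _:=_; con)

  private
    F : ℕ → Carrier
    F = fromℕ R

  fromℕ≡·1# : ∀ n → F n ≡ n · 1#
  fromℕ≡·1# zero    = ≡.refl
  fromℕ≡·1# (suc n) = ≡.cong (_+_ 1#) (fromℕ≡·1# n)

  fromℕ-+ : ∀ m n → F (m +ℕ n) ≈ F m + F n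
  fromℕ-+ m n rewrite fromℕ≡·1# (m +ℕ n) | fromℕ≡·1# m | fromℕ≡·1# n = ×-homo-+ 1# m n

  fromℕ-* : ∀ m n → F (m *ℕ n) ≈ F m * F n
  fromℕ-* m n rewrite fromℕ≡·1# (m *ℕ n) | fromℕ≡·1# m | fromℕ≡·1# n = ×1-homo-* m n

  pow-1#-* : ∀ n x → pow R 1# n * x ≈ x
  pow-1#-* zero    x = *-identityˡ x
  pow-1#-* (suc n) x = trans (*-congʳ (*-identityˡ _)) (pow-1#-* n x)

  pow-neg : ∀ x n → pow R (- 1#) n * pow R x n ≈ pow R (- x) n
  pow-neg x zero    = *-identityˡ 1#
  pow-neg x (suc n) = begin
    (- 1# * pow R (- 1#) n) * (x * pow R x n)   ≈⟨ solve 4 (λ m p x q → (m :* p) :* (x :* q) := (m :* x) :* (p :* q)) refl _ _ _ _ ⟩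
    (- 1# * x) * (pow R (- 1#) n * pow R x n)   ≈⟨ *-cong (-1*x≈-x x) (pow-neg x n) ⟩
    - x * pow R (- x) n                          ∎

  sumTo-cong : ∀ k {f g} → (∀ {j} → j ≤ k → f j ≈ g j) → sumTo R k f ≈ sumTo R k g
  sumTo-cong zero    f≈g = f≈g z≤n
  sumTo-cong (suc k) f≈g = +-cong (sumTo-cong k (λ j≤k → f≈g (m≤n⇒m≤1+n j≤k))) (f≈g ≤-refl)

  sumTo-+ : ∀ k f g → sumTo R k (λ j → f j + g j) ≈ sumTo R k f + sumTo R k g
  sumTo-+ zero    f g = refl
  sumTo-+ (suc k) f g = trans (+-congʳ (sumTo-+ k f g))
    (solve 4 (λ a b x y → (a :+ b) :+ (x :+ y) := (a :+ x) :+ (b :+ y)) refl _ _ _ _)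

  sumTo-* : ∀ k a f → sumTo R k (λ j → a * f j) ≈ a * sumTo R k f
  sumTo-* zero    a f = refl
  sumTo-* (suc k) a f = trans (+-congʳ (sumTo-* k a f)) (sym (distribˡ a _ _))

  sumTo-head : ∀ k f → sumTo R (suc k) f ≈ f 0 + sumTo R k (λ j → f (suc j))
  sumTo-head zero    f = refl
  sumTo-head (suc k) f = trans (+-congʳ (sumTo-head k f)) (+-assoc _ _ _)

  binomialSum : ℕ → (ℕ → ℕ → Carrier) → Carrier
  binomialSum k f = sumTo R k (λ j → F (k C j) * f (k ∸ j) j)

  binomialSum-* : ∀ k a {f g} → (∀ i j → f i j ≈ a * g i j) → binomialSum k f ≈ a * binomialSum k g
  binomialSum-* k a {f} {g} f≈ag = begin
    binomialSum k f                                  ≈⟨ sumTo-cong k (λ {j} _ → *-congˡ (f≈ag (k ∸ j) j)) ⟩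
    sumTo R k (λ j → F (k C j) * (a * g (k ∸ j) j))  ≈⟨ sumTo-cong k (λ _ → x*[a*y]≈a*[x*y] _ _ _) ⟩
    sumTo R k (λ j → a * (F (k C j) * g (k ∸ j) j))  ≈⟨ sumTo-* k a _ ⟩
    a * binomialSum k g                              ∎
    where
    x*[a*y]≈a*[x*y] : ∀ x a y → x * (a * y) ≈ a * (x * y)
    x*[a*y]≈a*[x*y] = solve 3 (λ x a y → x :* (a :* y) := a :* (x :* y)) refl

  binomialSum-pascal : ∀ k f →
    binomialSum (suc k) f ≈ binomialSum k (λ i j → f (suc i) j) + binomialSum k (λ i j → f i (suc j))
  binomialSum-pascal k f = begin
    binomialSum (suc k) f                                          ≈⟨ sumTo-head k _ ⟩
    u 0 + sumTo R k (λ j → F (suc k C suc j) * f (k ∸ j) (suc j))  ≈⟨ +-congˡ (sumTo-cong k (λ {j} _ → pascal j)) ⟩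
    u 0 + sumTo R k (λ j → u (suc j) + v j)                        ≈⟨ +-congˡ (sumTo-+ k _ v) ⟩
    u 0 + (sumTo R k (λ j → u (suc j)) + sumTo R k v)              ≈⟨ +-assoc _ _ _ ⟨
    (u 0 + sumTo R k (λ j → u (suc j))) + sumTo R k v              ≈⟨ +-congʳ (sumTo-head k u) ⟨
    (sumTo R k u + u (suc k)) + sumTo R k v                        ≈⟨ +-congʳ (trans (+-congˡ u-top≈0) (+-identityʳ _)) ⟩
    sumTo R k u + sumTo R k v                                      ≈⟨ +-congʳ (sumTo-cong k u-reindex) ⟩
    binomialSum k (λ i j → f (suc i) j) + binomialSum k (λ i j → f i (suc j)) ∎
    where
    u v : ℕ → Carrier
    u j = F (k C j) * f (suc k ∸ j) j
    v j = F (k C j) * f (k ∸ j) (suc j)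
    pascal : ∀ j → F (suc k C suc j) * f (k ∸ j) (suc j) ≈ u (suc j) + v j
    pascal j = begin
      F (suc k C suc j) * f (k ∸ j) (suc j)           ≡⟨ ≡.cong (λ n → F n * f (k ∸ j) (suc j)) (nCk+nC[k+1]≡[n+1]C[k+1] k j) ⟨
      F (k C j +ℕ k C suc j) * f (k ∸ j) (suc j)      ≈⟨ *-congʳ (fromℕ-+ (k C j) (k C suc j)) ⟩
      (F (k C j) + F (k C suc j)) * f (k ∸ j) (suc j) ≈⟨ distribʳ _ _ _ ⟩
      v j + u (suc j)                                 ≈⟨ +-comm _ _ ⟩
      u (suc j) + v j                                 ∎
    u-top≈0 : u (suc k) ≈ 0#
    u-top≈0 = trans (*-congʳ (reflexive (≡.cong F (k>n⇒nCk≡0 (n<1+n k))))) (zeroˡ _)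
    u-reindex : ∀ {j} → j ≤ k → u j ≈ F (k C j) * f (suc (k ∸ j)) j
    u-reindex {j} j≤k = reflexive (≡.cong (λ i → F (k C j) * f i j) (+-∸-assoc 1 j≤k))

  module _ (T : ℤ → Carrier) {α β γ : Carrier} {d e : ℤ}
           (relation : ∀ r → α * T (r +ℤ d) + β * T (r +ℤ e) ≈ γ * T r) where

    binomial-iteration : ∀ k r →
      binomialSum k (λ i j → (pow R α i * pow R β j) * T ((r +ℤ + i *ℤ d) +ℤ + j *ℤ e)) ≈ pow R γ k * T r
    binomial-iteration zero r = begin
      (1# + 0#) * ((1# * 1#) * T ((r +ℤ + 0 *ℤ d) +ℤ + 0 *ℤ e)) ≈⟨ *-congˡ (*-congˡ (reflexive (≡.cong T (index₀ r d e)))) ⟩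
      (1# + 0#) * ((1# * 1#) * T r)                             ≈⟨ solve 1 (λ t → (con 1 :+ con 0) :* ((con 1 :* con 1) :* t) := con 1 :* t) refl (T r) ⟩
      1# * T r                                                  ∎
      where
      index₀ : ∀ r d e → (r +ℤ + 0 *ℤ d) +ℤ + 0 *ℤ e ≡ r
      index₀ = solve-∀
    binomial-iteration (suc k) r = begin
      binomialSum (suc k) (term r)                                 ≈⟨ binomialSum-pascal k (term r) ⟩
      binomialSum k (λ i j → term r (suc i) j) + binomialSum k (λ i j → term r i (suc j))
        ≈⟨ +-cong (binomialSum-* k α stepA) (binomialSum-* k β stepB) ⟩
      α * binomialSum k (term (r +ℤ d)) + β * binomialSum k (term (r +ℤ e))
        ≈⟨ +-cong (*-congˡ (binomial-iteration k (r +ℤ d))) (*-congˡ (binomial-iteration k (r +ℤ e))) ⟩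
      α * (pow R γ k * T (r +ℤ d)) + β * (pow R γ k * T (r +ℤ e))
        ≈⟨ solve 5 (λ a b p x y → a :* (p :* x) :+ b :* (p :* y) := p :* (a :* x :+ b :* y)) refl _ _ _ _ _ ⟩
      pow R γ k * (α * T (r +ℤ d) + β * T (r +ℤ e))                ≈⟨ *-congˡ (relation r) ⟩
      pow R γ k * (γ * T r)                                        ≈⟨ solve 3 (λ p c t → p :* (c :* t) := (c :* p) :* t) refl _ _ _ ⟩
      pow R γ (suc k) * T r                                        ∎
      where
      term : ℤ → ℕ → ℕ → Carrier
      term r i j = (pow R α i * pow R β j) * T ((r +ℤ + i *ℤ d) +ℤ + j *ℤ e)
      indexA : ∀ r i j d e → (r +ℤ (+ 1 +ℤ i) *ℤ d) +ℤ j *ℤ e ≡ ((r +ℤ d) +ℤ i *ℤ d) +ℤ j *ℤ e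
      indexA = solve-∀
      indexB : ∀ r i j d e → (r +ℤ i *ℤ d) +ℤ (+ 1 +ℤ j) *ℤ e ≡ ((r +ℤ e) +ℤ i *ℤ d) +ℤ j *ℤ e
      indexB = solve-∀
      stepA : ∀ i j → term r (suc i) j ≈ α * term (r +ℤ d) i j
      stepA i j = trans (*-congˡ (reflexive (≡.cong T (indexA r (+ i) (+ j) d e))))
        (solve 4 (λ a p q t → (a :* p :* q) :* t := a :* ((p :* q) :* t)) refl _ _ _ _)
      stepB : ∀ i j → term r i (suc j) ≈ β * term (r +ℤ e) i j
      stepB i j = trans (*-congˡ (reflexive (≡.cong T (indexB r (+ i) (+ j) d e))))
        (solve 4 (λ b p q t → (p :* (b :* q)) :* t := b :* ((p :* q) :* t)) refl _ _ _ _)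

  IsTribonacciOnℕ : (ℕ → Carrier) → Set ℓ
  IsTribonacciOnℕ u = ∀ n → u (3 +ℕ n) ≈ (u (2 +ℕ n) + u (1 +ℕ n)) + u n

  tribonacci-unique : ∀ {u v} → IsTribonacciOnℕ u → IsTribonacciOnℕ v →
    u 0 ≈ v 0 → u 1 ≈ v 1 → u 2 ≈ v 2 → ∀ n → u n ≈ v n
  tribonacci-unique {u} {v} u-rec v-rec u₀≈v₀ u₁≈v₁ u₂≈v₂ n = let (uₙ≈vₙ , _ , _) = agree n in uₙ≈vₙ
    where
    agree : ∀ n → u n ≈ v n × u (1 +ℕ n) ≈ v (1 +ℕ n) × u (2 +ℕ n) ≈ v (2 +ℕ n)
    agree zero    = u₀≈v₀ , u₁≈v₁ , u₂≈v₂
    agree (suc n) = let (e₀ , e₁ , e₂) = agree n in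
      e₁ , e₂ , trans (u-rec n) (trans (+-cong (+-cong e₂ e₁) e₀) (sym (v-rec n)))

  module _ (T : ℤ → Carrier) where

    combination : ℤ → ℕ → ℕ → ℕ → Carrier
    combination s p q r = (F p * T s + F q * T (s +ℤ + 1)) + F r * T (s +ℤ + 2)

    combination-≡ : ∀ s {p q r p′ q′ r′} → p ≡ p′ → q ≡ q′ → r ≡ r′ → combination s p q r ≡ combination s p′ q′ r′
    combination-≡ s ≡.refl ≡.refl ≡.refl = ≡.refl

    combination-+ : ∀ s p q r p′ q′ r′ →
      combination s p q r + combination s p′ q′ r′ ≈ combination s (p +ℕ p′) (q +ℕ q′) (r +ℕ r′)
    combination-+ s p q r p′ q′ r′ = trans
      (solve 9 (λ p q r p′ q′ r′ x y z →
                 ((p :* x :+ q :* y) :+ r :* z) :+ ((p′ :* x :+ q′ :* y) :+ r′ :* z)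
              := ((p :+ p′) :* x :+ (q :+ q′) :* y) :+ (r :+ r′) :* z) refl _ _ _ _ _ _ _ _ _)
      (sym (+-cong (+-cong (*-congʳ (fromℕ-+ p p′)) (*-congʳ (fromℕ-+ q q′))) (*-congʳ (fromℕ-+ r r′))))

    combination-* : ∀ s m p q r → F m * combination s p q r ≈ combination s (m *ℕ p) (m *ℕ q) (m *ℕ r)
    combination-* s m p q r = trans
      (solve 7 (λ m p q r x y z → m :* ((p :* x :+ q :* y) :+ r :* z)
                               := ((m :* p) :* x :+ (m :* q) :* y) :+ (m :* r) :* z) refl _ _ _ _ _ _ _)
      (sym (+-cong (+-cong (*-congʳ (fromℕ-* m p)) (*-congʳ (fromℕ-* m q))) (*-congʳ (fromℕ-* m r))))

    expansion : ℤ → ℕ → Carrier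
    expansion s n = combination s (basis₀ n) (basis₁ n) (basis₂ n)

    expansion-isTribonacci : ∀ s → IsTribonacciOnℕ (expansion s)
    expansion-isTribonacci s n = begin
      expansion s (3 +ℕ n)
        ≡⟨ combination-≡ s (tribonacciℕ-rec 1 0 0 n) (tribonacciℕ-rec 0 1 0 n) (tribonacciℕ-rec 0 0 1 n) ⟩
      combination s ((p 2 +ℕ p 1) +ℕ p 0) ((q 2 +ℕ q 1) +ℕ q 0) ((r 2 +ℕ r 1) +ℕ r 0)
        ≈⟨ combination-+ s (p 2 +ℕ p 1) (q 2 +ℕ q 1) (r 2 +ℕ r 1) (p 0) (q 0) (r 0) ⟨
      combination s (p 2 +ℕ p 1) (q 2 +ℕ q 1) (r 2 +ℕ r 1) + expansion s n
        ≈⟨ +-congʳ (combination-+ s (p 2) (q 2) (r 2) (p 1) (q 1) (r 1)) ⟨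
      (expansion s (2 +ℕ n) + expansion s (1 +ℕ n)) + expansion s n ∎
      where
      p q r : ℕ → ℕ
      p i = basis₀ (i +ℕ n)
      q i = basis₁ (i +ℕ n)
      r i = basis₂ (i +ℕ n)

  module _ {T : ℤ → Carrier} (isTribonacci : IsTribonacci R T) where

    shift-isTribonacci : ∀ s → IsTribonacciOnℕ (λ n → T (s +ℤ + n))
    shift-isTribonacci s n = trans (isTribonacci _) (+-cong (+-cong (back 1 2) (back 2 1)) (back 3 0))
      where
      cancel : ∀ s a b n → (s +ℤ ((a +ℤ b) +ℤ n)) -ℤ a ≡ s +ℤ (b +ℤ n)
      cancel = solve-∀
      back : ∀ a b → T ((s +ℤ ((+ a +ℤ + b) +ℤ + n)) -ℤ + a) ≈ T (s +ℤ (+ b +ℤ + n))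
      back a b = reflexive (≡.cong T (cancel s (+ a) (+ b) (+ n)))

    tribonacci-expansion : ∀ s n → T (s +ℤ + n) ≈ expansion T s n
    tribonacci-expansion s = tribonacci-unique (shift-isTribonacci s) (expansion-isTribonacci T s)
      (trans (reflexive (≡.cong T (ℤP.+-identityʳ s)))
             (solve 3 (λ x y z → x := ((con 1 :+ con 0) :* x :+ con 0 :* y) :+ con 0 :* z) refl _ _ _))
      (solve 3 (λ x y z → y := (con 0 :* x :+ (con 1 :+ con 0) :* y) :+ con 0 :* z) refl _ _ _)
      (solve 3 (λ x y z → z := (con 0 :* x :+ con 0 :* y) :+ (con 1 :+ con 0) :* z) refl _ _ _)

    tribonacci-56-103 : ∀ s → F 56 * T (s +ℤ + 17) ≈ F 103 * T (s +ℤ + 16) + T s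
    tribonacci-56-103 s = begin
      F 56 * T (s +ℤ + 17)
        ≈⟨ *-congˡ (tribonacci-expansion s 17) ⟩
      F 56 * expansion T s 17
        ≈⟨ combination-* T s 56 (basis₀ 17) (basis₁ 17) (basis₂ 17) ⟩
      combination T s (56 *ℕ basis₀ 17) (56 *ℕ basis₁ 17) (56 *ℕ basis₂ 17)
        ≡⟨ combination-≡ T s 56·basis₀17 56·basis₁17 56·basis₂17 ⟩
      combination T s (103 *ℕ basis₀ 16 +ℕ 1) (103 *ℕ basis₁ 16 +ℕ 0) (103 *ℕ basis₂ 16 +ℕ 0)
        ≈⟨ combination-+ T s (103 *ℕ basis₀ 16) (103 *ℕ basis₁ 16) (103 *ℕ basis₂ 16) (basis₀ 0) (basis₁ 0) (basis₂ 0) ⟨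
      combination T s (103 *ℕ basis₀ 16) (103 *ℕ basis₁ 16) (103 *ℕ basis₂ 16) + expansion T s 0
        ≈⟨ +-congʳ (combination-* T s 103 (basis₀ 16) (basis₁ 16) (basis₂ 16)) ⟨
      F 103 * expansion T s 16 + expansion T s 0
        ≈⟨ +-cong (*-congˡ (tribonacci-expansion s 16)) (tribonacci-expansion s 0) ⟨
      F 103 * T (s +ℤ + 16) + T (s +ℤ + 0)
        ≡⟨ ≡.cong (λ t → F 103 * T (s +ℤ + 16) + T t) (ℤP.+-identityʳ s) ⟩
      F 103 * T (s +ℤ + 16) + T s ∎

    relation₁ : ∀ r → - F 103 * T (r +ℤ + 16) + F 56 * T (r +ℤ + 17) ≈ 1# * T r
    relation₁ r = begin
      - F 103 * T (r +ℤ + 16) + F 56 * T (r +ℤ + 17)   ≈⟨ +-congʳ (-‿distribˡ-* _ _) ⟨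
      - (F 103 * T (r +ℤ + 16)) + F 56 * T (r +ℤ + 17) ≈⟨ y≈x\\z _ _ _ (sym (tribonacci-56-103 r)) ⟨
      T r                                               ≈⟨ *-identityˡ _ ⟨
      1# * T r                                          ∎

    relation₂ : ∀ r → 1# * T (r +ℤ -ℤ + 17) + F 103 * T (r +ℤ (+ 16 -ℤ + 17)) ≈ F 56 * T r
    relation₂ r = begin
      1# * T (r +ℤ -ℤ + 17) + F 103 * T (r +ℤ (+ 16 -ℤ + 17)) ≈⟨ +-congʳ (*-identityˡ _) ⟩
      T (r +ℤ -ℤ + 17) + F 103 * T (r +ℤ (+ 16 -ℤ + 17))      ≈⟨ +-comm _ _ ⟩
      F 103 * T (r +ℤ (+ 16 -ℤ + 17)) + T (r +ℤ -ℤ + 17)      ≡⟨ ≡.cong (λ t → F 103 * T t + T (r +ℤ -ℤ + 17)) (shift16 r) ⟨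
      F 103 * T ((r +ℤ -ℤ + 17) +ℤ + 16) + T (r +ℤ -ℤ + 17)   ≈⟨ tribonacci-56-103 _ ⟨
      F 56 * T ((r +ℤ -ℤ + 17) +ℤ + 17)                       ≡⟨ ≡.cong (λ t → F 56 * T t) (shift17 r) ⟩
      F 56 * T r                                               ∎
      where
      shift16 : ∀ r → (r +ℤ -ℤ + 17) +ℤ + 16 ≡ r +ℤ (+ 16 -ℤ + 17)
      shift16 = solve-∀
      shift17 : ∀ r → (r +ℤ -ℤ + 17) +ℤ + 17 ≡ r
      shift17 = solve-∀

    relation₃ : ∀ r → 1# * T (r +ℤ -ℤ + 16) + - F 56 * T (r +ℤ (+ 17 -ℤ + 16)) ≈ - F 103 * T r
    relation₃ r = begin
      1# * T (r +ℤ -ℤ + 16) + - F 56 * T (r +ℤ (+ 17 -ℤ + 16))   ≈⟨ +-cong (*-identityˡ _) (sym (-‿distribˡ-* _ _)) ⟩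
      T (r +ℤ -ℤ + 16) - F 56 * T (r +ℤ (+ 17 -ℤ + 16))          ≈⟨ ⁻¹-anti-homo‿- _ _ ⟨
      - (F 56 * T (r +ℤ (+ 17 -ℤ + 16)) - T (r +ℤ -ℤ + 16))      ≈⟨ -‿cong (x≈z//y _ _ _ (sym key)) ⟨
      - (F 103 * T r)                                            ≈⟨ -‿distribˡ-* _ _ ⟩
      - F 103 * T r                                              ∎
      where
      shift16 : ∀ r → (r +ℤ -ℤ + 16) +ℤ + 16 ≡ r
      shift16 = solve-∀
      shift17 : ∀ r → (r +ℤ -ℤ + 16) +ℤ + 17 ≡ r +ℤ (+ 17 -ℤ + 16)
      shift17 = solve-∀
      key : F 56 * T (r +ℤ (+ 17 -ℤ + 16)) ≈ F 103 * T r + T (r +ℤ -ℤ + 16)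
      key = begin
        F 56 * T (r +ℤ (+ 17 -ℤ + 16))                          ≡⟨ ≡.cong (λ t → F 56 * T t) (shift17 r) ⟨
        F 56 * T ((r +ℤ -ℤ + 16) +ℤ + 17)                       ≈⟨ tribonacci-56-103 _ ⟩
        F 103 * T ((r +ℤ -ℤ + 16) +ℤ + 16) + T (r +ℤ -ℤ + 16)   ≡⟨ ≡.cong (λ t → F 103 * T t + T (r +ℤ -ℤ + 16)) (shift16 r) ⟩
        F 103 * T r + T (r +ℤ -ℤ + 16)                          ∎

    tribonacci-binomial₁ : ∀ k r →
      sumTo R k (λ j → ((((pow R (- 1#) (k ∸ j)) * F (k C j)) * pow R (F 103) (k ∸ j)) * pow R (F 56) j)
                         * T (r +ℤ + (16 *ℕ k +ℕ j)))
      ≈ T r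
    tribonacci-binomial₁ k r =
      trans (sumTo-cong k summand) (trans (binomial-iteration T relation₁ k r) (pow-1#-* k (T r)))
      where
      summand : ∀ {j} → j ≤ k →
        ((((pow R (- 1#) (k ∸ j)) * F (k C j)) * pow R (F 103) (k ∸ j)) * pow R (F 56) j) * T (r +ℤ + (16 *ℕ k +ℕ j))
        ≈ F (k C j) * ((pow R (- F 103) (k ∸ j) * pow R (F 56) j) * T ((r +ℤ + (k ∸ j) *ℤ + 16) +ℤ + j *ℤ + 17))
      summand {j} j≤k = trans
        (solve 5 (λ m c p q t → (((m :* c) :* p) :* q) :* t := c :* (((m :* p) :* q) :* t)) refl _ _ _ _ _)
        (*-congˡ (*-cong (*-congʳ (pow-neg (F 103) (k ∸ j))) (reflexive (≡.cong T (index₁ r j≤k)))))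

    tribonacci-binomial₂ : ∀ k r →
      sumTo R k (λ j → ((pow R (F 103) j) * F (k C j)) * T ((r -ℤ + (17 *ℕ k)) +ℤ + (16 *ℕ j)))
      ≈ pow R (F 56) k * T r
    tribonacci-binomial₂ k r = trans (sumTo-cong k summand) (binomial-iteration T relation₂ k r)
      where
      summand : ∀ {j} → j ≤ k →
        ((pow R (F 103) j) * F (k C j)) * T ((r -ℤ + (17 *ℕ k)) +ℤ + (16 *ℕ j))
        ≈ F (k C j) * ((pow R 1# (k ∸ j) * pow R (F 103) j) * T ((r +ℤ + (k ∸ j) *ℤ (-ℤ + 17)) +ℤ + j *ℤ (+ 16 -ℤ + 17)))
      summand {j} j≤k = trans
        (solve 3 (λ q c t → (q :* c) :* t := c :* (q :* t)) refl _ _ _)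
        (*-congˡ (*-cong (sym (pow-1#-* (k ∸ j) _)) (reflexive (≡.cong T (index₂ r j≤k)))))

    tribonacci-binomial₃ : ∀ k r →
      sumTo R k (λ j → (((pow R (- 1#) j) * F (k C j)) * pow R (F 56) j) * T ((r -ℤ + (16 *ℕ k)) +ℤ + (17 *ℕ j)))
      ≈ pow R (- F 103) k * T r
    tribonacci-binomial₃ k r = trans (sumTo-cong k summand) (binomial-iteration T relation₃ k r)
      where
      summand : ∀ {j} → j ≤ k →
        (((pow R (- 1#) j) * F (k C j)) * pow R (F 56) j) * T ((r -ℤ + (16 *ℕ k)) +ℤ + (17 *ℕ j))
        ≈ F (k C j) * ((pow R 1# (k ∸ j) * pow R (- F 56) j) * T ((r +ℤ + (k ∸ j) *ℤ (-ℤ + 16)) +ℤ + j *ℤ (+ 17 -ℤ + 16)))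
      summand {j} j≤k = trans
        (solve 4 (λ m c q t → ((m :* c) :* q) :* t := c :* ((m :* q) :* t)) refl _ _ _ _)
        (*-congˡ (*-cong (trans (pow-neg (F 56) j) (sym (pow-1#-* (k ∸ j) _))) (reflexive (≡.cong T (index₃ r j≤k)))))

theorem10 : ∀ {c ℓ} (R : CommutativeRing c ℓ) (T : ℤ → CommutativeRing.Carrier R)
    → IsTribonacci R T
    → ∀ (k : ℕ) (r : ℤ)
    → let open CommutativeRing R in
      (sumTo R k (λ j → ((((pow R (- 1#) (k ∸ j)) * fromℕ R (k C j)) * pow R (fromℕ R 103) (k ∸ j)) * pow R (fromℕ R 56) j) * T (r +ℤ + (16 *ℕ k +ℕ j))) ≈ T r)
      × (sumTo R k (λ j → ((pow R (fromℕ R 103) j) * fromℕ R (k C j)) * T ((r -ℤ + (17 *ℕ k)) +ℤ + (16 *ℕ j))) ≈ pow R (fromℕ R 56) k * T r)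
      × (sumTo R k (λ j → (((pow R (- 1#) j) * fromℕ R (k C j)) * pow R (fromℕ R 56) j) * T ((r -ℤ + (16 *ℕ k)) +ℤ + (17 *ℕ j))) ≈ pow R (- fromℕ R 103) k * T r)
theorem10 R T isTribonacci k r =
  tribonacci-binomial₁ R isTribonacci k r , tribonacci-binomial₂ R isTribonacci k r , tribonacci-binomial₃ R isTribonacci k r
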